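{- Fix $k\in\mathbb Z_{\ge0}$ and an irreducible fraction $t\in(0,1)$, and put $w_{k,t}=\dfrac{u^+_{k,t}v^-_{k,t}+1}{m_{k,t}}$. Then (1) $M_t(k,0)=\begin{bmatrix}-v^-_{k,t}&m_{k,t}\\-w_{k,t}&u^+_{k,t}\end{bmatrix}$; (2) $C_t(k,-k)=\begin{bmatrix}u^+_{k,t}&m_{k,t}\\(3k+3)u^+_{k,t}-w_{k,t}&(3k+3)m_{k,t}-v^-_{k,t}\end{bmatrix}$.
   Context: Fix $k\in\mathbb Z_{\ge0}$. Farey tree $\mathrm{F}\mathbb T$: root $\left(\frac01,\frac11,\frac10\right)$; a vertex $\left(\frac ab,\frac cd,\frac ef\right)$ has left child $\left(\frac ab,\frac{a+c}{b+d},\frac cd\right)$ and right child $\left(\frac cd,\frac{c+e}{d+f},\frac ef\right)$; each positive irreducible fraction is the middle entry of exactly one vertex. $\mathrm{M}\mathbb T(k)$: root $(1,k+2,1)$; vertex $(a,b,c)$ has left child $\left(a,\frac{a^2+kab+b^2}{c},b\right)$ and right child $\left(b,\frac{b^2+kbc+c^2}{a},c\right)$. $\mathrm{MM}\mathbb T(k,0)$: root $\left(\begin{bmatrix}0&1\\-1&-k\end{bmatrix},\begin{bmatrix}-k-1&k+2\\-1&1\end{bmatrix},\begin{bmatrix}-k-1&1\\-k-2&1\end{bmatrix}\right)$; vertex $(X,Y,Z)$ has left child $(X,YZY^{ -1},Y)$ and right child $(Y,Y^{ -1}XY,Z)$. With $S=\begin{bmatrix}k&0\\3k^2+3k&k\end{bmatrix}$,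 $\mathrm{GC}\mathbb T(k,-k)$: root $\left(\begin{bmatrix}-k&1\\-3k^2-3k-1&3k+3\end{bmatrix},\begin{bmatrix}1&k+2\\3k+2&3k^2+8k+5\end{bmatrix},\begin{bmatrix}1&1\\2k+1&2k+2\end{bmatrix}\right)$; vertex $(P,Q,R)$ has left child $(P,PQ-S,Q)$ and right child $(Q,QR-S,R)$. For binary trees, "the corresponding vertex" refers to the unique bijection from $\mathrm{F}\mathbb T$ preserving the root and left/right children. For an irreducible $t>0$, $M_t(k,0)$ (resp. $C_t(k,-k)$) is the second component of the vertex of $\mathrm{MM}\mathbb T(k,0)$ (resp. $\mathrm{GC}\mathbb T(k,-k)$) corresponding to the vertex of $\mathrm{F}\mathbb T$ with middle entry $t$. For $t\in(0,1)$ with corresponding vertices $(r,t,s)\in\mathrm{F}\mathbb T$ and $(m_r,m_t,m_s)\in\mathrm{M}\mathbb T(k)$, set $m_{k,t}=m_t$; $u^+_{k,t}$ is the unique $x\in(0,m_t)$ with $m_rx\equiv m_s$, and $v^-_{k,t}$ the unique $x\in(0,m_t)$ with $m_sx\equiv -m_r\pmod{m_t}$. -}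

module Defs where

open import Data.Nat as ℕ using (ℕ; zero; suc)
import Data.Nat.DivMod as ℕD
open import Data.Integer as ℤ using (ℤ; +_; -_)
open import Data.Integer.Divisibility as ℤDiv using ()
open import Data.Product using (_×_; _,_; proj₁; proj₂)
open import Data.List using (List; []; _∷_)

-- Binary-tree vertices are addressed by paths from the root.
-- The "corresponding vertex" bijection between two such trees is:
-- same path.

data Dir : Set where
  L R : Dir

walk : {A : Set} → (A → A) → (A → A) → A → List Dir → A
walk l r x []      = x
walk l r x (L ∷ p) = walk l r (l x) p
walk l r x (R ∷ p) = walk l r (r x) p

Triple : Set → Set
Triple A = A × A × A

fstT : {A : Set} → Triple A → A
fstT (x , _ , _) = x

midT : {A : Set} → Triple A → A
midT (_ , y , _) = y

lstT : {A : Set} → Triple A → A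
lstT (_ , _ , z) = z

-- Farey tree.  A fraction a/b is the pair (a , b) (1/0 allowed).

Frac : Set
Frac = ℕ × ℕ

mediant : Frac → Frac → Frac
mediant (a , b) (c , d) = (a ℕ.+ c , b ℕ.+ d)

fareyRoot : Triple Frac
fareyRoot = ((0 , 1) , (1 , 1) , (1 , 0))

fareyL fareyR : Triple Frac → Triple Frac
fareyL (x , y , z) = (x , mediant x y , y)
fareyR (x , y , z) = (y , mediant y z , z)

fareyAt : List Dir → Triple Frac
fareyAt = walk fareyL fareyR fareyRoot

-- The division is exact in the tree; divℕ is
-- ordinary natural-number division (returning 0 on a zero divisor,
-- which never occurs in the tree since all entries are positive).

divℕ : ℕ → ℕ → ℕ
divℕ n zero    = 0
divℕ n (suc c) = n ℕD./ suc c

markovRoot : ℕ → Triple ℕ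
markovRoot k = (1 , k ℕ.+ 2 , 1)

markovL markovR : ℕ → Triple ℕ → Triple ℕ
markovL k (a , b , c) = (a , divℕ (a ℕ.* a ℕ.+ k ℕ.* a ℕ.* b ℕ.+ b ℕ.* b) c , b)
markovR k (a , b , c) = (b , divℕ (b ℕ.* b ℕ.+ k ℕ.* b ℕ.* c ℕ.+ c ℕ.* c) a , c)

markovAt : ℕ → List Dir → Triple ℕ
markovAt k = walk (markovL k) (markovR k) (markovRoot k)

record Mat2 : Set where
  constructor mat
  field
    e11 e12 e21 e22 : ℤ

infixl 7 _·_
_·_ : Mat2 → Mat2 → Mat2
mat a b c d · mat a' b' c' d' =
  mat (a ℤ.* a' ℤ.+ b ℤ.* c') (a ℤ.* b' ℤ.+ b ℤ.* d')
      (c ℤ.* a' ℤ.+ d ℤ.* c') (c ℤ.* b' ℤ.+ d ℤ.* d')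

infixl 6 _⊖_
_⊖_ : Mat2 → Mat2 → Mat2
mat a b c d ⊖ mat a' b' c' d' = mat (a ℤ.- a') (b ℤ.- b') (c ℤ.- c') (d ℤ.- d')

-- Inverse of a determinant-1 matrix (all matrices of MMT(k,0) have
-- determinant 1: the root ones do, and conjugation preserves it).
inv : Mat2 → Mat2
inv (mat a b c d) = mat d (- b) (- c) a

mmRoot : ℕ → Triple Mat2
mmRoot k =
  ( mat (+ 0) (+ 1) (- + 1) (- K)
  , mat (- K ℤ.- + 1) (K ℤ.+ + 2) (- + 1) (+ 1)
  , mat (- K ℤ.- + 1) (+ 1) (- K ℤ.- + 2) (+ 1) )
  where K = + k

mmL mmR : Triple Mat2 → Triple Mat2
mmL (X , Y , Z) = (X , Y · Z · inv Y , Y)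
mmR (X , Y , Z) = (Y , inv Y · X · Y , Z)

mmAt : ℕ → List Dir → Triple Mat2
mmAt k = walk mmL mmR (mmRoot k)

gcS : ℕ → Mat2
gcS k = mat K (+ 0) (+ 3 ℤ.* K ℤ.* K ℤ.+ + 3 ℤ.* K) K
  where K = + k

gcRoot : ℕ → Triple Mat2
gcRoot k =
  ( mat (- K) (+ 1) (- (+ 3 ℤ.* K ℤ.* K ℤ.+ + 3 ℤ.* K ℤ.+ + 1)) (+ 3 ℤ.* K ℤ.+ + 3)
  , mat (+ 1) (K ℤ.+ + 2) (+ 3 ℤ.* K ℤ.+ + 2) (+ 3 ℤ.* K ℤ.* K ℤ.+ + 8 ℤ.* K ℤ.+ + 5)
  , mat (+ 1) (+ 1) (+ 2 ℤ.* K ℤ.+ + 1) (+ 2 ℤ.* K ℤ.+ + 2) )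
  where K = + k

gcL gcR : ℕ → Triple Mat2 → Triple Mat2
gcL k (P , Q , R′) = (P , P · Q ⊖ gcS k , Q)
gcR k (P , Q , R′) = (Q , Q · R′ ⊖ gcS k , R′)

gcAt : ℕ → List Dir → Triple Mat2
gcAt k = walk (gcL k) (gcR k) (gcRoot k)

-- M_t(k,0), C_t(k,-k), m_{k,t}, u^+, v^-, w  (t given by its Farey path p)

Mt : ℕ → List Dir → Mat2
Mt k p = midT (mmAt k p)

Ct : ℕ → List Dir → Mat2
Ct k p = midT (gcAt k p)

m-t m-r m-s : ℕ → List Dir → ℕ
m-t k p = midT (markovAt k p)
m-r k p = fstT (markovAt k p)
m-s k p = lstT (markovAt k p)

IsUPlus : ℕ → List Dir → ℕ → Set
IsUPlus k p x = (0 ℕ.< x) × (x ℕ.< m-t k p) ×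
  (+ m-t k p ℤDiv.∣ (+ m-r k p ℤ.* + x ℤ.- + m-s k p))

IsVMinus : ℕ → List Dir → ℕ → Set
IsVMinus k p x = (0 ℕ.< x) × (x ℕ.< m-t k p) ×
  (+ m-t k p ℤDiv.∣ (+ m-s k p ℤ.* + x ℤ.+ + m-r k p))

-- w = (u v + 1) / m_t   (natural-number quotient; exactness is asserted
-- separately in the theorem)
w-of : ℕ → List Dir → ℕ → ℕ → ℕ
w-of k p u v = divℕ (u ℕ.* v ℕ.+ 1) (m-t k p)

{-# OPTIONS --safe #-}
module Submission where

-- Every vertex (X, Y, Z) of MMT(k,0) consists of matrices of determinant 1 and trace -k with
-- X Y Z = 𝓝 = [[-1,0],[3k+3,-1]], and the middle matrices of its two children are the jumps
-- X⁻¹ 𝓝 Y⁻¹ and Y⁻¹ 𝓝 Z⁻¹.  By Cayley–Hamilton for W = Y 𝓛 X, with 𝓛 = [[1,0],[3k+3,1]], the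
-- jump X⁻¹ 𝓝 Y⁻¹ equals W - k; hence φ A = 𝓛 σ A (σ the reflection in the antidiagonal)
-- carries MMT(k,0) vertexwise onto GCT(k,-k), so C_t = φ M_t.  On upper right entries the
-- jumps act as the Vieta involution of the Markov-type equation, so these entries form the
-- triples of MT(k).  Writing M_t = [[-(d+k), m], [-w, d]], the relations X Y = 𝓝 Z⁻¹ and
-- Y Z = X⁻¹ 𝓝 give m_r d ≡ m_s and m_s (d+k) ≡ -m_r modulo m, two inequalities carried along
-- the tree give 0 < d ≤ d + k < m, and det M_t = 1 gives m w = d (d+k) + 1.  So d = u⁺ and
-- d + k = v⁻.

open import Defs
open import Data.Nat as ℕ using (ℕ; _<_; _*_; _+_)
open import Data.Nat.Divisibility using (_∣_)
open import Data.Nat.Coprimality using (Coprime)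
open import Data.Integer as ℤ using (+_; -_)
open import Data.Product using (_×_; _,_)
open import Data.List using (List)
open import Relation.Binary.PropositionalEquality using (_≡_)

open import Data.Empty using (⊥-elim)
open import Data.Integer using (ℤ; -[1+_]; -1ℤ; +≤+; +<+)
import Data.Integer.Divisibility as ℤ∣
import Data.Integer.Divisibility.Signed as ℤ∣ˢ
import Data.Integer.Properties as ℤP
open import Data.Integer.Tactic.RingSolver using (solve; solve-∀)
import Data.Nat.Coprimality as Coprime
import Data.Nat.Divisibility as ℕ∣
import Data.Nat.DivMod as ℕDivMod
import Data.Nat.Properties as ℕP
import Data.Nat.Tactic.RingSolver as ℕSolver
open import Data.List using (_∷_; [])
open import Data.Product using (proj₁; proj₂)
open import Function.Base using (_∋_)
open import Relation.Binary.PropositionalEquality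
  using (refl; sym; trans; cong; cong₂; subst; subst₂; module ≡-Reasoning)

open Mat2 using (e11; e12; e21; e22)

walk-related : {A B : Set} (_∼_ : A → B → Set) {l r : A → A} {l′ r′ : B → B} →
  (∀ {x y} → x ∼ y → l x ∼ l′ y) → (∀ {x y} → x ∼ y → r x ∼ r′ y) →
  ∀ p {x y} → x ∼ y → walk l r x p ∼ walk l′ r′ y p
walk-related _∼_ stepL stepR []      x∼y = x∼y
walk-related _∼_ stepL stepR (L ∷ p) x∼y = walk-related _∼_ stepL stepR p (stepL x∼y)
walk-related _∼_ stepL stepR (R ∷ p) x∼y = walk-related _∼_ stepL stepR p (stepR x∼y)

mapT : {A B : Set} → (A → B) → Triple A → Triple B
mapT f (x , y , z) = (f x , f y , f z)

mat-cong : ∀ {a b c d a′ b′ c′ d′} → a ≡ a′ → b ≡ b′ → c ≡ c′ → d ≡ d′ →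
           mat a b c d ≡ mat a′ b′ c′ d′
mat-cong refl refl refl refl = refl

det tr : Mat2 → ℤ
det (mat a b c d) = a ℤ.* d ℤ.- b ℤ.* c
tr  (mat a b c d) = a ℤ.+ d

scalar : ℤ → Mat2
scalar t = mat t (+ 0) (+ 0) t

σ : Mat2 → Mat2
σ (mat a b c d) = mat d b c a

-- Pattern synonyms, so that the ring solver sees their entries.
pattern 𝓛 s = mat (+ 1) (+ 0) s (+ 1)
pattern 𝓝 s = mat -[1+ 0 ] (+ 0) s -[1+ 0 ]

φ : ℤ → Mat2 → Mat2
φ s (mat a b c d) = mat d b (s ℤ.* d ℤ.+ c) (s ℤ.* b ℤ.+ a)

κ : ℤ → ℤ
κ K = + 3 ℤ.* K ℤ.+ + 3

jump : ℤ → Mat2 → Mat2 → Mat2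
jump K A B = inv A · 𝓝 (κ K) · inv B

-- gcS k is 𝓢 (+ k).
𝓢 : ℤ → Mat2
𝓢 K = mat K (+ 0) (+ 3 ℤ.* K ℤ.* K ℤ.+ + 3 ℤ.* K) K

-- The ring solver reads its goal only up to weak head normal form, so each identity below is
-- either restated with the matrix operations unfolded (by _∋_) or derived entrywise from a
-- generic ring identity.

·-assoc : ∀ A B C → A · B · C ≡ A · (B · C)
·-assoc A B C = mat-cong
  (entry (e11 A) (e12 A) (e11 B) (e21 B) (e12 B) (e22 B) (e11 C) (e21 C))
  (entry (e11 A) (e12 A) (e11 B) (e21 B) (e12 B) (e22 B) (e12 C) (e22 C))
  (entry (e21 A) (e22 A) (e11 B) (e21 B) (e12 B) (e22 B) (e11 C) (e21 C))
  (entry (e21 A) (e22 A) (e11 B) (e21 B) (e12 B) (e22 B) (e12 C) (e22 C))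
  where
  entry : ∀ x y p q r s u v →
    (x ℤ.* p ℤ.+ y ℤ.* q) ℤ.* u ℤ.+ (x ℤ.* r ℤ.+ y ℤ.* s) ℤ.* v ≡
    x ℤ.* (p ℤ.* u ℤ.+ r ℤ.* v) ℤ.+ y ℤ.* (q ℤ.* u ℤ.+ s ℤ.* v)
  entry = solve-∀

·-identityˡ : ∀ A → scalar (+ 1) · A ≡ A
·-identityˡ (mat a b c d) = mat-cong
  (solve (a ∷ c ∷ [])) (solve (b ∷ d ∷ [])) (solve (a ∷ c ∷ [])) (solve (b ∷ d ∷ []))

·-identityʳ : ∀ A → A · scalar (+ 1) ≡ A
·-identityʳ (mat a b c d) = mat-cong
  (solve (a ∷ b ∷ [])) (solve (a ∷ b ∷ [])) (solve (c ∷ d ∷ [])) (solve (c ∷ d ∷ []))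

scalar-comm : ∀ A t → A · scalar t ≡ scalar t · A
scalar-comm (mat a b c d) t =
  (mat a b c d · mat t (+ 0) (+ 0) t ≡ mat t (+ 0) (+ 0) t · mat a b c d) ∋ mat-cong
  (solve (a ∷ b ∷ c ∷ d ∷ t ∷ [])) (solve (a ∷ b ∷ c ∷ d ∷ t ∷ []))
  (solve (a ∷ b ∷ c ∷ d ∷ t ∷ [])) (solve (a ∷ b ∷ c ∷ d ∷ t ∷ []))

·-inverseʳ : ∀ A → A · inv A ≡ scalar (det A)
·-inverseʳ (mat a b c d) =
  (mat a b c d · mat d (- b) (- c) a ≡ scalar (a ℤ.* d ℤ.- b ℤ.* c)) ∋ mat-cong
  (solve (a ∷ b ∷ c ∷ d ∷ [])) (solve (a ∷ b ∷ c ∷ d ∷ []))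
  (solve (a ∷ b ∷ c ∷ d ∷ [])) (solve (a ∷ b ∷ c ∷ d ∷ []))

·-inverseˡ : ∀ A → inv A · A ≡ scalar (det A)
·-inverseˡ (mat a b c d) =
  (mat d (- b) (- c) a · mat a b c d ≡ scalar (a ℤ.* d ℤ.- b ℤ.* c)) ∋ mat-cong
  (solve (a ∷ b ∷ c ∷ d ∷ [])) (solve (a ∷ b ∷ c ∷ d ∷ []))
  (solve (a ∷ b ∷ c ∷ d ∷ [])) (solve (a ∷ b ∷ c ∷ d ∷ []))

-- inv A is the adjugate of A, so this says -adj A = A - tr A.
cayley-hamilton : ∀ A → inv A · scalar -1ℤ ≡ A ⊖ scalar (tr A)
cayley-hamilton (mat a b c d) =
  (mat d (- b) (- c) a · scalar -1ℤ ≡ mat a b c d ⊖ mat (a ℤ.+ d) (+ 0) (+ 0) (a ℤ.+ d)) ∋ mat-cong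
  (solve (a ∷ b ∷ c ∷ d ∷ [])) (solve (a ∷ b ∷ c ∷ d ∷ []))
  (solve (a ∷ b ∷ c ∷ d ∷ [])) (solve (a ∷ b ∷ c ∷ d ∷ []))

det-· : ∀ A B → det (A · B) ≡ det A ℤ.* det B
det-· (mat a₁ a₂ a₃ a₄) (mat b₁ b₂ b₃ b₄) =
  ((a₁ ℤ.* b₁ ℤ.+ a₂ ℤ.* b₃) ℤ.* (a₃ ℤ.* b₂ ℤ.+ a₄ ℤ.* b₄)
     ℤ.- (a₁ ℤ.* b₂ ℤ.+ a₂ ℤ.* b₄) ℤ.* (a₃ ℤ.* b₁ ℤ.+ a₄ ℤ.* b₃)
   ≡ (a₁ ℤ.* a₄ ℤ.- a₂ ℤ.* a₃) ℤ.* (b₁ ℤ.* b₄ ℤ.- b₂ ℤ.* b₃))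
  ∋ solve (a₁ ∷ a₂ ∷ a₃ ∷ a₄ ∷ b₁ ∷ b₂ ∷ b₃ ∷ b₄ ∷ [])

det-inv : ∀ A → det (inv A) ≡ det A
det-inv (mat a b c d) =
  (d ℤ.* a ℤ.- - b ℤ.* - c ≡ a ℤ.* d ℤ.- b ℤ.* c) ∋ solve (a ∷ b ∷ c ∷ d ∷ [])

det-𝓛 : ∀ s → det (𝓛 s) ≡ + 1
det-𝓛 s = (+ 1 ℤ.* + 1 ℤ.- + 0 ℤ.* s ≡ + 1) ∋ solve (s ∷ [])

tr-comm : ∀ A B → tr (A · B) ≡ tr (B · A)
tr-comm (mat a₁ a₂ a₃ a₄) (mat b₁ b₂ b₃ b₄) =
  (a₁ ℤ.* b₁ ℤ.+ a₂ ℤ.* b₃ ℤ.+ (a₃ ℤ.* b₂ ℤ.+ a₄ ℤ.* b₄) ≡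
   b₁ ℤ.* a₁ ℤ.+ b₂ ℤ.* a₃ ℤ.+ (b₃ ℤ.* a₂ ℤ.+ b₄ ℤ.* a₄))
  ∋ solve (a₁ ∷ a₂ ∷ a₃ ∷ a₄ ∷ b₁ ∷ b₂ ∷ b₃ ∷ b₄ ∷ [])

σ-· : ∀ A B → σ (A · B) ≡ σ B · σ A
σ-· A B = mat-cong
  (swap (e21 A) (e12 B) (e22 A) (e22 B)) (swap (e11 A) (e12 B) (e12 A) (e22 B))
  (swap (e21 A) (e11 B) (e22 A) (e21 B)) (swap (e11 A) (e11 B) (e12 A) (e21 B))
  where
  swap : ∀ x p y q → x ℤ.* p ℤ.+ y ℤ.* q ≡ q ℤ.* y ℤ.+ p ℤ.* x
  swap = solve-∀

φ≡𝓛·σ : ∀ s A → φ s A ≡ 𝓛 s · σ A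
φ≡𝓛·σ s (mat a b c d) = (φ s (mat a b c d) ≡ 𝓛 s · mat d b c a) ∋ mat-cong
  (solve (s ∷ a ∷ b ∷ c ∷ d ∷ [])) (solve (s ∷ a ∷ b ∷ c ∷ d ∷ []))
  (solve (s ∷ a ∷ b ∷ c ∷ d ∷ [])) (solve (s ∷ a ∷ b ∷ c ∷ d ∷ []))

φ-shift : ∀ K A → φ (κ K) (A ⊖ scalar K) ≡ φ (κ K) A ⊖ 𝓢 K
φ-shift K (mat a b c d) =
  (φ (+ 3 ℤ.* K ℤ.+ + 3) (mat (a ℤ.- K) (b ℤ.- + 0) (c ℤ.- + 0) (d ℤ.- K)) ≡
   mat d b ((+ 3 ℤ.* K ℤ.+ + 3) ℤ.* d ℤ.+ c) ((+ 3 ℤ.* K ℤ.+ + 3) ℤ.* b ℤ.+ a)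
     ⊖ mat K (+ 0) (+ 3 ℤ.* K ℤ.* K ℤ.+ + 3 ℤ.* K) K) ∋ mat-cong
  (solve (K ∷ a ∷ b ∷ c ∷ d ∷ [])) (solve (K ∷ a ∷ b ∷ c ∷ d ∷ []))
  (solve (K ∷ a ∷ b ∷ c ∷ d ∷ [])) (solve (K ∷ a ∷ b ∷ c ∷ d ∷ []))

𝓛·𝓝 : ∀ s → 𝓛 s · 𝓝 s ≡ scalar -1ℤ
𝓛·𝓝 s = mat-cong (solve (s ∷ [])) (solve (s ∷ [])) (solve (s ∷ [])) (solve (s ∷ []))

e12-𝓝·inv : ∀ s A → e12 (𝓝 s · inv A) ≡ e12 A
e12-𝓝·inv s (mat a b c d) = (-[1+ 0 ] ℤ.* - b ℤ.+ + 0 ℤ.* a ≡ b) ∋ solve (a ∷ b ∷ [])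

e12-inv·𝓝 : ∀ s A → e12 (inv A · 𝓝 s) ≡ e12 A
e12-inv·𝓝 s (mat a b c d) = (d ℤ.* + 0 ℤ.+ - b ℤ.* -[1+ 0 ] ≡ b) ∋ solve (b ∷ d ∷ [])

tr-·𝓛 : ∀ s A → tr (A · 𝓛 s) ≡ tr A ℤ.+ s ℤ.* e12 A
tr-·𝓛 s (mat a b c d) =
  (a ℤ.* + 1 ℤ.+ b ℤ.* s ℤ.+ (c ℤ.* + 0 ℤ.+ d ℤ.* + 1) ≡ a ℤ.+ d ℤ.+ s ℤ.* b)
  ∋ solve (s ∷ a ∷ b ∷ c ∷ d ∷ [])

tr-𝓝·inv : ∀ s A → tr (𝓝 s · inv A) ≡ - tr A ℤ.- s ℤ.* e12 A
tr-𝓝·inv s (mat a b c d) =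
  (-[1+ 0 ] ℤ.* d ℤ.+ + 0 ℤ.* - c ℤ.+ (s ℤ.* - b ℤ.+ -[1+ 0 ] ℤ.* a) ≡ - (a ℤ.+ d) ℤ.- s ℤ.* b)
  ∋ solve (s ∷ a ∷ b ∷ c ∷ d ∷ [])

tr-inv·𝓝 : ∀ s A → tr (inv A · 𝓝 s) ≡ - tr A ℤ.- s ℤ.* e12 A
tr-inv·𝓝 s (mat a b c d) =
  (d ℤ.* -[1+ 0 ] ℤ.+ - b ℤ.* s ℤ.+ (- c ℤ.* + 0 ℤ.+ a ℤ.* -[1+ 0 ]) ≡ - (a ℤ.+ d) ℤ.- s ℤ.* b)
  ∋ solve (s ∷ a ∷ b ∷ c ∷ d ∷ [])

e11-from-tr : ∀ {K} A → tr A ≡ - K → e11 A ≡ - (e22 A ℤ.+ K)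
e11-from-tr A = solve-for-x (e11 A) (e22 A)
  where
  solve-for-x : ∀ {K} x y → x ℤ.+ y ≡ - K → x ≡ - (y ℤ.+ K)
  solve-for-x {K} x y x+y≡-K = begin
    x                  ≡⟨ solve (x ∷ y ∷ []) ⟩
    x ℤ.+ y ℤ.- y      ≡⟨ cong (ℤ._- y) x+y≡-K ⟩
    - K ℤ.- y          ≡⟨ solve (K ∷ y ∷ []) ⟩
    - (y ℤ.+ K)        ∎
    where open ≡-Reasoning

module _ (A B : Mat2) where
  open ≡-Reasoning

  A·B·B⁻¹≡A : det B ≡ + 1 → A · B · inv B ≡ A
  A·B·B⁻¹≡A detB≡1 = begin
    A · B · inv B        ≡⟨ ·-assoc A B (inv B) ⟩
    A · (B · inv B)      ≡⟨ cong (A ·_) (trans (·-inverseʳ B) (cong scalar detB≡1)) ⟩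
    A · scalar (+ 1)     ≡⟨ ·-identityʳ A ⟩
    A                    ∎

  A·B⁻¹·B≡A : det B ≡ + 1 → A · inv B · B ≡ A
  A·B⁻¹·B≡A detB≡1 = begin
    A · inv B · B        ≡⟨ ·-assoc A (inv B) B ⟩
    A · (inv B · B)      ≡⟨ cong (A ·_) (trans (·-inverseˡ B) (cong scalar detB≡1)) ⟩
    A · scalar (+ 1)     ≡⟨ ·-identityʳ A ⟩
    A                    ∎

  A⁻¹·[A·B]≡B : det A ≡ + 1 → inv A · (A · B) ≡ B
  A⁻¹·[A·B]≡B detA≡1 = begin
    inv A · (A · B)      ≡⟨ ·-assoc (inv A) A B ⟨
    inv A · A · B        ≡⟨ cong (_· B) (trans (·-inverseˡ A) (cong scalar detA≡1)) ⟩
    scalar (+ 1) · B     ≡⟨ ·-identityˡ B ⟩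
    B                    ∎

  A·[A⁻¹·B]≡B : det A ≡ + 1 → A · (inv A · B) ≡ B
  A·[A⁻¹·B]≡B detA≡1 = begin
    A · (inv A · B)      ≡⟨ ·-assoc A (inv A) B ⟨
    A · inv A · B        ≡⟨ cong (_· B) (trans (·-inverseʳ A) (cong scalar detA≡1)) ⟩
    scalar (+ 1) · B     ≡⟨ ·-identityˡ B ⟩
    B                    ∎

  tr-conj : det A ≡ + 1 → tr (A · B · inv A) ≡ tr B
  tr-conj detA≡1 = trans (tr-comm (A · B) (inv A)) (cong tr (A⁻¹·[A·B]≡B detA≡1))

  tr-conj⁻¹ : det A ≡ + 1 → tr (inv A · B · A) ≡ tr B
  tr-conj⁻¹ detA≡1 = trans (tr-comm (inv A · B) A) (cong tr (A·[A⁻¹·B]≡B detA≡1))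

  det-conj : det A ≡ + 1 → det B ≡ + 1 → det (A · B · inv A) ≡ + 1
  det-conj detA≡1 detB≡1 = trans (det-· (A · B) (inv A))
    (cong₂ ℤ._*_ (trans (det-· A B) (cong₂ ℤ._*_ detA≡1 detB≡1)) (trans (det-inv A) detA≡1))

  det-conj⁻¹ : det A ≡ + 1 → det B ≡ + 1 → det (inv A · B · A) ≡ + 1
  det-conj⁻¹ detA≡1 detB≡1 = trans (det-· (inv A · B) A)
    (cong₂ ℤ._*_ (trans (det-· (inv A) B) (cong₂ ℤ._*_ (trans (det-inv A) detA≡1) detB≡1)) detA≡1)

φ-·𝓛· : ∀ s A B → φ s (B · 𝓛 s · A) ≡ φ s A · φ s B
φ-·𝓛· s A B = begin
  φ s (B · 𝓛 s · A)           ≡⟨ φ≡𝓛·σ s (B · 𝓛 s · A) ⟩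
  𝓛 s · σ (B · 𝓛 s · A)       ≡⟨ cong (𝓛 s ·_) (trans (σ-· (B · 𝓛 s) A) (cong (σ A ·_) (σ-· B (𝓛 s)))) ⟩
  𝓛 s · (σ A · (𝓛 s · σ B))   ≡⟨ ·-assoc (𝓛 s) (σ A) (𝓛 s · σ B) ⟨
  𝓛 s · σ A · (𝓛 s · σ B)     ≡⟨ cong₂ _·_ (φ≡𝓛·σ s A) (φ≡𝓛·σ s B) ⟨
  φ s A · φ s B               ∎
  where open ≡-Reasoning

-- With W = B 𝓛 A we have W · jump K A B = -1, and Cayley–Hamilton gives -W⁻¹ = W - tr W.
jump-cayley-hamilton : ∀ {K} A B → det A ≡ + 1 → det B ≡ + 1 → tr (A · B · 𝓛 (κ K)) ≡ K →
  jump K A B ≡ B · 𝓛 (κ K) · A ⊖ scalar K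
jump-cayley-hamilton {K} A B detA≡1 detB≡1 trAB𝓛≡K = begin
  J                        ≡⟨ A⁻¹·[A·B]≡B W J detW≡1 ⟨
  inv W · (W · J)          ≡⟨ cong (inv W ·_) W·J≡-1 ⟩
  inv W · scalar -1ℤ       ≡⟨ cayley-hamilton W ⟩
  W ⊖ scalar (tr W)        ≡⟨ cong (λ t → W ⊖ scalar t) trW≡K ⟩
  W ⊖ scalar K             ∎
  where
  open ≡-Reasoning
  Lκ Nκ W J : Mat2
  Lκ = 𝓛 (κ K)
  Nκ = 𝓝 (κ K)
  W = B · Lκ · A
  J = jump K A B

  detW≡1 : det W ≡ + 1
  detW≡1 = trans (det-· (B · Lκ) A)
    (cong₂ ℤ._*_ (trans (det-· B Lκ) (cong₂ ℤ._*_ detB≡1 (det-𝓛 (κ K)))) detA≡1)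

  trW≡K : tr W ≡ K
  trW≡K = trans (tr-comm (B · Lκ) A) (trans (cong tr (sym (·-assoc A B Lκ))) trAB𝓛≡K)

  W·J≡-1 : W · J ≡ scalar -1ℤ
  W·J≡-1 = begin
    B · Lκ · A · (inv A · Nκ · inv B)     ≡⟨ cong (W ·_) (·-assoc (inv A) Nκ (inv B)) ⟩
    B · Lκ · A · (inv A · (Nκ · inv B))   ≡⟨ ·-assoc (B · Lκ) A (inv A · (Nκ · inv B)) ⟩
    B · Lκ · (A · (inv A · (Nκ · inv B))) ≡⟨ cong (B · Lκ ·_) (A·[A⁻¹·B]≡B A (Nκ · inv B) detA≡1) ⟩
    B · Lκ · (Nκ · inv B)                 ≡⟨ ·-assoc (B · Lκ) Nκ (inv B) ⟨
    B · Lκ · Nκ · inv B                   ≡⟨ cong (_· inv B) (·-assoc B Lκ Nκ) ⟩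
    B · (Lκ · Nκ) · inv B                 ≡⟨ cong (λ M → B · M · inv B) (𝓛·𝓝 (κ K)) ⟩
    B · scalar -1ℤ · inv B                ≡⟨ cong (_· inv B) (scalar-comm B -1ℤ) ⟩
    scalar -1ℤ · B · inv B                ≡⟨ A·B·B⁻¹≡A (scalar -1ℤ) B detB≡1 ⟩
    scalar -1ℤ                            ∎

φ-jump : ∀ {K} A B → det A ≡ + 1 → det B ≡ + 1 → tr (A · B · 𝓛 (κ K)) ≡ K →
  φ (κ K) (jump K A B) ≡ φ (κ K) A · φ (κ K) B ⊖ 𝓢 K
φ-jump {K} A B detA≡1 detB≡1 trAB𝓛≡K = begin
  φ (κ K) (jump K A B)
    ≡⟨ cong (φ (κ K)) (jump-cayley-hamilton A B detA≡1 detB≡1 trAB𝓛≡K) ⟩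
  φ (κ K) (B · 𝓛 (κ K) · A ⊖ scalar K)
    ≡⟨ φ-shift K (B · 𝓛 (κ K) · A) ⟩
  φ (κ K) (B · 𝓛 (κ K) · A) ⊖ 𝓢 K
    ≡⟨ cong (_⊖ 𝓢 K) (φ-·𝓛· (κ K) A B) ⟩
  φ (κ K) A · φ (κ K) B ⊖ 𝓢 K
    ∎
  where open ≡-Reasoning

-- The Markov-type form and its Vieta involution

markovForm : ℤ → ℤ → ℤ → ℤ → ℤ
markovForm K a b c =
  a ℤ.* a ℤ.+ b ℤ.* b ℤ.+ c ℤ.* c ℤ.+ K ℤ.* (a ℤ.* b ℤ.+ b ℤ.* c ℤ.+ c ℤ.* a)
  ℤ.- κ K ℤ.* a ℤ.* b ℤ.* c

-- The root other than c of markovForm K a b x, as a quadratic polynomial in x.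
vieta : ℤ → ℤ → ℤ → ℤ → ℤ
vieta K a b c = κ K ℤ.* a ℤ.* b ℤ.- K ℤ.* a ℤ.- K ℤ.* b ℤ.- c

markovForm-rotate : ∀ K a b c → markovForm K a b c ≡ markovForm K b c a
markovForm-rotate K a b c =
  (let F x y z = x ℤ.* x ℤ.+ y ℤ.* y ℤ.+ z ℤ.* z ℤ.+ K ℤ.* (x ℤ.* y ℤ.+ y ℤ.* z ℤ.+ z ℤ.* x)
                 ℤ.- (+ 3 ℤ.* K ℤ.+ + 3) ℤ.* x ℤ.* y ℤ.* z
   in F a b c ≡ F b c a) ∋ solve (K ∷ a ∷ b ∷ c ∷ [])

markovForm-vieta : ∀ K a b c → markovForm K a (vieta K a b c) b ≡ markovForm K a b c
markovForm-vieta K a b c =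
  (let F x y z = x ℤ.* x ℤ.+ y ℤ.* y ℤ.+ z ℤ.* z ℤ.+ K ℤ.* (x ℤ.* y ℤ.+ y ℤ.* z ℤ.+ z ℤ.* x)
                 ℤ.- (+ 3 ℤ.* K ℤ.+ + 3) ℤ.* x ℤ.* y ℤ.* z
       v = (+ 3 ℤ.* K ℤ.+ + 3) ℤ.* a ℤ.* b ℤ.- K ℤ.* a ℤ.- K ℤ.* b ℤ.- c
   in F a v b ≡ F a b c) ∋ solve (K ∷ a ∷ b ∷ c ∷ [])

vieta-product : ∀ K a b c →
  c ℤ.* vieta K a b c ≡ a ℤ.* a ℤ.+ K ℤ.* a ℤ.* b ℤ.+ b ℤ.* b ℤ.- markovForm K a b c
vieta-product K a b c =
  (let s = + 3 ℤ.* K ℤ.+ + 3 in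
   c ℤ.* (s ℤ.* a ℤ.* b ℤ.- K ℤ.* a ℤ.- K ℤ.* b ℤ.- c) ≡
   a ℤ.* a ℤ.+ K ℤ.* a ℤ.* b ℤ.+ b ℤ.* b
     ℤ.- (a ℤ.* a ℤ.+ b ℤ.* b ℤ.+ c ℤ.* c ℤ.+ K ℤ.* (a ℤ.* b ℤ.+ b ℤ.* c ℤ.+ c ℤ.* a)
          ℤ.- s ℤ.* a ℤ.* b ℤ.* c)) ∋ solve (K ∷ a ∷ b ∷ c ∷ [])

-- The tree MMT(k,0) and its image GCT(k,-k)

record IsMMTriple (K : ℤ) (X Y Z : Mat2) : Set where
  field
    detX : det X ≡ + 1
    detY : det Y ≡ + 1
    detZ : det Z ≡ + 1
    trX : tr X ≡ - K
    trY : tr Y ≡ - K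
    trZ : tr Z ≡ - K
    product : X · Y · Z ≡ 𝓝 (κ K)

MMTriple : ℤ → Triple Mat2 → Set
MMTriple K (X , Y , Z) = IsMMTriple K X Y Z

module IsMMTripleProperties {K X Y Z} (t : IsMMTriple K X Y Z) where
  open IsMMTriple t
  open ≡-Reasoning

  X·Y≡𝓝·Z⁻¹ : X · Y ≡ 𝓝 (κ K) · inv Z
  X·Y≡𝓝·Z⁻¹ = trans (sym (A·B·B⁻¹≡A (X · Y) Z detZ)) (cong (_· inv Z) product)

  Y·Z≡X⁻¹·𝓝 : Y · Z ≡ inv X · 𝓝 (κ K)
  Y·Z≡X⁻¹·𝓝 = trans (sym (A⁻¹·[A·B]≡B X (Y · Z) detX))
                    (cong (inv X ·_) (trans (sym (·-assoc X Y Z)) product))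

  conjˡ≡jump : Y · Z · inv Y ≡ jump K X Y
  conjˡ≡jump = cong (_· inv Y) Y·Z≡X⁻¹·𝓝

  conjʳ≡jump : inv Y · X · Y ≡ jump K Y Z
  conjʳ≡jump = begin
    inv Y · X · Y              ≡⟨ ·-assoc (inv Y) X Y ⟩
    inv Y · (X · Y)            ≡⟨ cong (inv Y ·_) X·Y≡𝓝·Z⁻¹ ⟩
    inv Y · (𝓝 (κ K) · inv Z)  ≡⟨ ·-assoc (inv Y) (𝓝 (κ K)) (inv Z) ⟨
    jump K Y Z                 ∎

  e12-X·Y : e12 (X · Y) ≡ e12 Z
  e12-X·Y = trans (cong e12 X·Y≡𝓝·Z⁻¹) (e12-𝓝·inv (κ K) Z)

  e12-Y·Z : e12 (Y · Z) ≡ e12 X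
  e12-Y·Z = trans (cong e12 Y·Z≡X⁻¹·𝓝) (e12-inv·𝓝 (κ K) X)

  private
    neg-tr-cancel : ∀ {t} s e → t ≡ - K → - t ℤ.- s ℤ.* e ℤ.+ s ℤ.* e ≡ K
    neg-tr-cancel s e refl = solve (K ∷ s ∷ e ∷ [])

  tr-X·Y·𝓛 : tr (X · Y · 𝓛 (κ K)) ≡ K
  tr-X·Y·𝓛 = begin
    tr (X · Y · 𝓛 (κ K))                          ≡⟨ tr-·𝓛 (κ K) (X · Y) ⟩
    tr (X · Y) ℤ.+ κ K ℤ.* e12 (X · Y)             ≡⟨ cong₂ (λ t e → t ℤ.+ κ K ℤ.* e)
                                                            (trans (cong tr X·Y≡𝓝·Z⁻¹) (tr-𝓝·inv (κ K) Z))
                                                            e12-X·Y ⟩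
    - tr Z ℤ.- κ K ℤ.* e12 Z ℤ.+ κ K ℤ.* e12 Z     ≡⟨ neg-tr-cancel (κ K) (e12 Z) trZ ⟩
    K                                              ∎

  tr-Y·Z·𝓛 : tr (Y · Z · 𝓛 (κ K)) ≡ K
  tr-Y·Z·𝓛 = begin
    tr (Y · Z · 𝓛 (κ K))                          ≡⟨ tr-·𝓛 (κ K) (Y · Z) ⟩
    tr (Y · Z) ℤ.+ κ K ℤ.* e12 (Y · Z)             ≡⟨ cong₂ (λ t e → t ℤ.+ κ K ℤ.* e)
                                                            (trans (cong tr Y·Z≡X⁻¹·𝓝) (tr-inv·𝓝 (κ K) X))
                                                            e12-Y·Z ⟩
    - tr X ℤ.- κ K ℤ.* e12 X ℤ.+ κ K ℤ.* e12 X     ≡⟨ neg-tr-cancel (κ K) (e12 X) trX ⟩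
    K                                              ∎

  φ-conjˡ : φ (κ K) (Y · Z · inv Y) ≡ φ (κ K) X · φ (κ K) Y ⊖ 𝓢 K
  φ-conjˡ = trans (cong (φ (κ K)) conjˡ≡jump) (φ-jump X Y detX detY tr-X·Y·𝓛)

  φ-conjʳ : φ (κ K) (inv Y · X · Y) ≡ φ (κ K) Y · φ (κ K) Z ⊖ 𝓢 K
  φ-conjʳ = trans (cong (φ (κ K)) conjʳ≡jump) (φ-jump Y Z detY detZ tr-Y·Z·𝓛)

  private
    vieta-from-φ : ∀ {p q c} x a b y → p ≡ - (x ℤ.+ K) → q ≡ - (y ℤ.+ K) → p ℤ.* b ℤ.+ a ℤ.* y ≡ c →
      x ℤ.* b ℤ.+ a ℤ.* ((+ 3 ℤ.* K ℤ.+ + 3) ℤ.* b ℤ.+ q) ℤ.- + 0 ≡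
      (+ 3 ℤ.* K ℤ.+ + 3) ℤ.* a ℤ.* b ℤ.- K ℤ.* a ℤ.- K ℤ.* b ℤ.- c
    vieta-from-φ x a b y refl refl refl = solve (K ∷ x ∷ a ∷ b ∷ y ∷ [])

  e12-conjˡ : e12 (Y · Z · inv Y) ≡ vieta K (e12 X) (e12 Y) (e12 Z)
  e12-conjˡ = trans (cong e12 φ-conjˡ)
    (vieta-from-φ (e22 X) (e12 X) (e12 Y) (e22 Y) (e11-from-tr X trX) (e11-from-tr Y trY) e12-X·Y)

  e12-conjʳ : e12 (inv Y · X · Y) ≡ vieta K (e12 Y) (e12 Z) (e12 X)
  e12-conjʳ = trans (cong e12 φ-conjʳ)
    (vieta-from-φ (e22 Y) (e12 Y) (e12 Z) (e22 Z) (e11-from-tr Y trY) (e11-from-tr Z trZ) e12-Y·Z)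

  e12X·e22Y : e12 X ℤ.* e22 Y ≡ e12 Z ℤ.+ e12 Y ℤ.* (e22 X ℤ.+ K)
  e12X·e22Y = from-e12-X·Y (e22 X) (e12 X) (e12 Y) (e22 Y) (e11-from-tr X trX) e12-X·Y
    where
    from-e12-X·Y : ∀ {p c} q a b y → p ≡ - (q ℤ.+ K) → p ℤ.* b ℤ.+ a ℤ.* y ≡ c →
                   a ℤ.* y ≡ c ℤ.+ b ℤ.* (q ℤ.+ K)
    from-e12-X·Y q a b y refl refl = solve (K ∷ q ∷ a ∷ b ∷ y ∷ [])

  e22Y+K·e12Z : (e22 Y ℤ.+ K) ℤ.* e12 Z ℤ.+ e12 X ≡ e12 Y ℤ.* e22 Z
  e22Y+K·e12Z = from-e12-Y·Z (e22 Y) (e12 Z) (e12 Y) (e22 Z) (e11-from-tr Y trY) e12-Y·Z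
    where
    from-e12-Y·Z : ∀ {p a} y c b z → p ≡ - (y ℤ.+ K) → p ℤ.* c ℤ.+ b ℤ.* z ≡ a →
                   (y ℤ.+ K) ℤ.* c ℤ.+ a ≡ b ℤ.* z
    from-e12-Y·Z y c b z refl refl = solve (K ∷ y ∷ c ∷ b ∷ z ∷ [])

  e12Y·-e21Y : e12 Y ℤ.* (- e21 Y) ≡ e22 Y ℤ.* (e22 Y ℤ.+ K) ℤ.+ + 1
  e12Y·-e21Y = from-det (e22 Y) (e12 Y) (e21 Y) (e11-from-tr Y trY) detY
    where
    from-det : ∀ {p} y b w → p ≡ - (y ℤ.+ K) → p ℤ.* y ℤ.- b ℤ.* w ≡ + 1 →
               b ℤ.* (- w) ≡ y ℤ.* (y ℤ.+ K) ℤ.+ + 1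
    from-det y b w refl detY≡1 = begin
      b ℤ.* (- w)                                           ≡⟨ solve (K ∷ y ∷ b ∷ w ∷ []) ⟩
      y ℤ.* (y ℤ.+ K) ℤ.+ (- (y ℤ.+ K) ℤ.* y ℤ.- b ℤ.* w)   ≡⟨ cong (λ d → y ℤ.* (y ℤ.+ K) ℤ.+ d) detY≡1 ⟩
      y ℤ.* (y ℤ.+ K) ℤ.+ + 1                               ∎

mmL-preserves : ∀ {K} T → MMTriple K T → MMTriple K (mmL T)
mmL-preserves {K} (X , Y , Z) t = record
  { detX = detX ; detY = det-conj Y Z detY detZ ; detZ = detY
  ; trX = trX ; trY = trans (tr-conj Y Z detY) trZ ; trZ = trY
  ; product = begin
      X · (Y · Z · inv Y) · Y     ≡⟨ ·-assoc X (Y · Z · inv Y) Y ⟩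
      X · (Y · Z · inv Y · Y)     ≡⟨ cong (X ·_) (A·B⁻¹·B≡A (Y · Z) Y detY) ⟩
      X · (Y · Z)                 ≡⟨ ·-assoc X Y Z ⟨
      X · Y · Z                   ≡⟨ product ⟩
      𝓝 (κ K)                     ∎
  }
  where open IsMMTriple t; open ≡-Reasoning

mmR-preserves : ∀ {K} T → MMTriple K T → MMTriple K (mmR T)
mmR-preserves {K} (X , Y , Z) t = record
  { detX = detY ; detY = det-conj⁻¹ Y X detY detX ; detZ = detZ
  ; trX = trY ; trY = trans (tr-conj⁻¹ Y X detY) trX ; trZ = trZ
  ; product = begin
      Y · (inv Y · X · Y) · Z     ≡⟨ cong (λ M → Y · M · Z) (·-assoc (inv Y) X Y) ⟩
      Y · (inv Y · (X · Y)) · Z   ≡⟨ cong (_· Z) (A·[A⁻¹·B]≡B Y (X · Y) detY) ⟩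
      X · Y · Z                   ≡⟨ product ⟩
      𝓝 (κ K)                     ∎
  }
  where open IsMMTriple t; open ≡-Reasoning

mmRoot-isMMTriple : ∀ k → MMTriple (+ k) (mmRoot k)
mmRoot-isMMTriple k = record
  { detX = detX₀ (+ k) ; detY = detY₀ (+ k) ; detZ = detZ₀ (+ k)
  ; trX = trX₀ (+ k) ; trY = trY₀ (+ k) ; trZ = trY₀ (+ k)
  ; product = product₀ (+ k)
  }
  where
  detX₀ : ∀ K → + 0 ℤ.* - K ℤ.- + 1 ℤ.* - + 1 ≡ + 1
  detX₀ = solve-∀
  detY₀ : ∀ K → (- K ℤ.- + 1) ℤ.* + 1 ℤ.- (K ℤ.+ + 2) ℤ.* - + 1 ≡ + 1
  detY₀ = solve-∀
  detZ₀ : ∀ K → (- K ℤ.- + 1) ℤ.* + 1 ℤ.- + 1 ℤ.* (- K ℤ.- + 2) ≡ + 1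
  detZ₀ = solve-∀
  trX₀ : ∀ K → + 0 ℤ.+ - K ≡ - K
  trX₀ = solve-∀
  trY₀ : ∀ K → - K ℤ.- + 1 ℤ.+ + 1 ≡ - K
  trY₀ = solve-∀
  product₀ : ∀ K → mat (+ 0) (+ 1) (- + 1) (- K) · mat (- K ℤ.- + 1) (K ℤ.+ + 2) (- + 1) (+ 1)
                   · mat (- K ℤ.- + 1) (+ 1) (- K ℤ.- + 2) (+ 1) ≡ 𝓝 (κ K)
  product₀ K = trans (cong (_· mat (- K ℤ.- + 1) (+ 1) (- K ℤ.- + 2) (+ 1)) X₀·Y₀) X₀·Y₀·Z₀
    where
    X₀·Y₀ : mat (+ 0) (+ 1) (- + 1) (- K) · mat (- K ℤ.- + 1) (K ℤ.+ + 2) (- + 1) (+ 1)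
            ≡ mat (- + 1) (+ 1) (+ 2 ℤ.* K ℤ.+ + 1) (- (+ 2 ℤ.* K ℤ.+ + 2))
    X₀·Y₀ = mat-cong (solve (K ∷ [])) (solve (K ∷ [])) (solve (K ∷ [])) (solve (K ∷ []))
    X₀·Y₀·Z₀ : mat (- + 1) (+ 1) (+ 2 ℤ.* K ℤ.+ + 1) (- (+ 2 ℤ.* K ℤ.+ + 2))
               · mat (- K ℤ.- + 1) (+ 1) (- K ℤ.- + 2) (+ 1) ≡ 𝓝 (+ 3 ℤ.* K ℤ.+ + 3)
    X₀·Y₀·Z₀ = mat-cong (solve (K ∷ [])) (solve (K ∷ [])) (solve (K ∷ [])) (solve (K ∷ []))

gcRoot≡φ-mmRoot : ∀ k → gcRoot k ≡ mapT (φ (κ (+ k))) (mmRoot k)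
gcRoot≡φ-mmRoot k = cong₂ _,_ (φX₀ (+ k)) (cong₂ _,_ (φY₀ (+ k)) (φZ₀ (+ k)))
  where
  φX₀ : ∀ K → mat (- K) (+ 1) (- (+ 3 ℤ.* K ℤ.* K ℤ.+ + 3 ℤ.* K ℤ.+ + 1)) (+ 3 ℤ.* K ℤ.+ + 3)
              ≡ φ (+ 3 ℤ.* K ℤ.+ + 3) (mat (+ 0) (+ 1) (- + 1) (- K))
  φX₀ K = mat-cong (solve (K ∷ [])) (solve (K ∷ [])) (solve (K ∷ [])) (solve (K ∷ []))
  φY₀ : ∀ K → mat (+ 1) (K ℤ.+ + 2) (+ 3 ℤ.* K ℤ.+ + 2) (+ 3 ℤ.* K ℤ.* K ℤ.+ + 8 ℤ.* K ℤ.+ + 5)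
              ≡ φ (+ 3 ℤ.* K ℤ.+ + 3) (mat (- K ℤ.- + 1) (K ℤ.+ + 2) (- + 1) (+ 1))
  φY₀ K = mat-cong (solve (K ∷ [])) (solve (K ∷ [])) (solve (K ∷ [])) (solve (K ∷ []))
  φZ₀ : ∀ K → mat (+ 1) (+ 1) (+ 2 ℤ.* K ℤ.+ + 1) (+ 2 ℤ.* K ℤ.+ + 2)
              ≡ φ (+ 3 ℤ.* K ℤ.+ + 3) (mat (- K ℤ.- + 1) (+ 1) (- K ℤ.- + 2) (+ 1))
  φZ₀ K = mat-cong (solve (K ∷ [])) (solve (K ∷ [])) (solve (K ∷ [])) (solve (K ∷ []))

module _ (k : ℕ) where
  private
    K : ℤ
    K = + k

  GCOverMM : Triple Mat2 → Triple Mat2 → Set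
  GCOverMM T G = MMTriple K T × G ≡ mapT (φ (κ K)) T

  gcL-over-mmL : ∀ {T G} → GCOverMM T G → GCOverMM (mmL T) (gcL k G)
  gcL-over-mmL {X , Y , Z} (t , refl) =
    mmL-preserves (X , Y , Z) t , cong (λ M → φ (κ K) X , M , φ (κ K) Y) (sym φ-conjˡ)
    where open IsMMTripleProperties t

  gcR-over-mmR : ∀ {T G} → GCOverMM T G → GCOverMM (mmR T) (gcR k G)
  gcR-over-mmR {X , Y , Z} (t , refl) =
    mmR-preserves (X , Y , Z) t , cong (λ M → φ (κ K) Y , M , φ (κ K) Z) (sym φ-conjʳ)
    where open IsMMTripleProperties t

  gcAt≡φ-mmAt : ∀ p → gcAt k p ≡ mapT (φ (κ K)) (mmAt k p)
  gcAt≡φ-mmAt p = proj₂ (walk-related GCOverMM gcL-over-mmL gcR-over-mmR p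
    (mmRoot-isMMTriple k , gcRoot≡φ-mmRoot k))

pos-quadratic : ∀ k a b →
  + (a * a + k * a * b + b * b) ≡ + a ℤ.* + a ℤ.+ + k ℤ.* + a ℤ.* + b ℤ.+ + b ℤ.* + b
pos-quadratic k a b = cong₂ ℤ._+_ (cong₂ ℤ._+_ (ℤP.pos-* a a) k*a*b) (ℤP.pos-* b b)
  where
  k*a*b : + (k * a * b) ≡ + k ℤ.* + a ℤ.* + b
  k*a*b = trans (ℤP.pos-* (k * a) b) (cong (ℤ._* + b) (ℤP.pos-* k a))

exact-quotient : ∀ {c q} {v : ℤ} → 0 < c → + c ℤ.* v ≡ + q → c * divℕ q c ≡ q × + divℕ q c ≡ v
exact-quotient {ℕ.suc c} {v = + n} _ c*n≡q with ℤP.+-injective (trans (ℤP.pos-* (ℕ.suc c) n) c*n≡q)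
... | refl = cong (ℕ.suc c *_) quotient≡n , cong +_ quotient≡n
  where
  quotient≡n : divℕ (ℕ.suc c * n) (ℕ.suc c) ≡ n
  quotient≡n = trans (cong (ℕDivMod._/ ℕ.suc c) (ℕP.*-comm (ℕ.suc c) n)) (ℕDivMod.m*n/n≡m n (ℕ.suc c))
exact-quotient {ℕ.suc c} {v = -[1+ n ]} _ ()

quotient-positive : ∀ {c n q} → 0 < q → c * n ≡ q → 0 < n
quotient-positive {c} {ℕ.zero} q>0 refl = ⊥-elim (ℕP.<-irrefl refl (subst (0 <_) (ℕP.*-zeroʳ c) q>0))
quotient-positive {n = ℕ.suc n} _ _ = ℕ.s≤s ℕ.z≤n

quadratic-positive : ∀ k a b → 0 < a → 0 < a * a + k * a * b + b * b
quadratic-positive k (ℕ.suc a) b _ = ℕ.s≤s ℕ.z≤n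

coprime-jump : ∀ {a b c n s} → Coprime a b → c * n ≡ a * s + b * b → Coprime a n
coprime-jump {a} {b} {c} {n} {s} coprime-ab c*n≡a*s+b*b {d} (d∣a , d∣n) = coprime-ab (d∣a , d∣b)
  where
  d∣b*b : d ∣ b * b
  d∣b*b = ℕ∣.∣m+n∣m⇒∣n (subst (d ∣_) c*n≡a*s+b*b (ℕ∣.∣n⇒∣m*n c d∣n)) (ℕ∣.∣m⇒∣m*n s d∣a)
  d∣b : d ∣ b
  d∣b = Coprime.coprime-divisor (λ (e∣d , e∣b) → coprime-ab (ℕ∣.∣-trans e∣d d∣a , e∣b)) d∣b*b

multiple-below : ∀ {b n} → b ∣ n → n < b → n ≡ 0
multiple-below {n = ℕ.zero}  _   _   = refl
multiple-below {n = ℕ.suc n} b∣n n<b = ⊥-elim (ℕ∣.>⇒∤ n<b b∣n)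

residue-unique : ∀ {a b x y} r → Coprime b a → x < b → y < b →
  + b ℤ∣.∣ + a ℤ.* + x ℤ.+ r → + b ℤ∣.∣ + a ℤ.* + y ℤ.+ r → x ≡ y
residue-unique {a} {b} {x} {y} r coprime-ba x<b y<b b∣ax+r b∣ay+r =
  ℤP.+-injective (ℤP.i-j≡0⇒i≡j (+ x) (+ y) (ℤP.∣i∣≡0⇒i≡0 ∣x-y∣≡0))
  where
  difference : ∀ A X Y r → A ℤ.* X ℤ.+ r ℤ.- (A ℤ.* Y ℤ.+ r) ≡ A ℤ.* (X ℤ.- Y)
  difference = solve-∀
  b∣a*[x-y] : + b ℤ∣ˢ.∣ + a ℤ.* (+ x ℤ.- + y)
  b∣a*[x-y] = subst (+ b ℤ∣ˢ.∣_) (difference (+ a) (+ x) (+ y) r)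
    (ℤ∣ˢ.∣m∣n⇒∣m-n {m = + a ℤ.* + x ℤ.+ r} {n = + a ℤ.* + y ℤ.+ r}
                   (ℤ∣ˢ.∣ᵤ⇒∣ b∣ax+r) (ℤ∣ˢ.∣ᵤ⇒∣ b∣ay+r))
  b∣∣x-y∣ : b ∣ ℤ.∣ + x ℤ.- + y ∣
  b∣∣x-y∣ = Coprime.coprime-divisor coprime-ba
              (subst (b ∣_) (ℤP.abs-* (+ a) (+ x ℤ.- + y)) (ℤ∣ˢ.∣⇒∣ᵤ b∣a*[x-y]))
  ∣x-y∣<b : ℤ.∣ + x ℤ.- + y ∣ < b
  ∣x-y∣<b = subst (_< b) (cong ℤ.∣_∣ (sym (ℤP.[+m]-[+n]≡m⊖n x y)))
              (ℕP.≤-<-trans (ℤP.∣m⊝n∣≤m⊔n x y) (ℕP.⊔-lub x<b y<b))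
  ∣x-y∣≡0 : ℤ.∣ + x ℤ.- + y ∣ ≡ 0
  ∣x-y∣≡0 = multiple-below b∣∣x-y∣ ∣x-y∣<b

factor-positive : ∀ {a b c s y} → 0 < a → 0 < c → + 0 ℤ.≤ s →
  + a ℤ.* y ≡ + c ℤ.+ + b ℤ.* s → + 0 ℤ.< y
factor-positive {a} {b} {c} {+ s} {y} a>0 c>0 (+≤+ _) a*y≡c+b*s =
  ℤP.*-cancelˡ-<-nonNeg (+ a) (begin-strict
    + a ℤ.* + 0             ≡⟨ ℤP.*-zeroʳ (+ a) ⟩
    + 0                     <⟨ +<+ (ℕP.<-≤-trans c>0 (ℕP.m≤m+n c (b * s))) ⟩
    + (c + b * s)           ≡⟨ cong (λ x → + c ℤ.+ x) (ℤP.pos-* b s) ⟩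
    + c ℤ.+ + b ℤ.* + s     ≡⟨ a*y≡c+b*s ⟨
    + a ℤ.* y               ∎)
  where open ℤP.≤-Reasoning

factor-below : ∀ {a b c t z} → 0 < a → z ℤ.≤ + c →
  t ℤ.* + c ℤ.+ + a ≡ + b ℤ.* z → t ℤ.< + b
factor-below {a} {b} {c} {t} {z} a>0 z≤c t*c+a≡b*z =
  ℤP.*-cancelʳ-<-nonNeg (+ c) (begin-strict
    t ℤ.* + c               ≡⟨ ℤP.+-identityʳ (t ℤ.* + c) ⟨
    t ℤ.* + c ℤ.+ + 0       <⟨ ℤP.+-monoʳ-< (t ℤ.* + c) (+<+ a>0) ⟩
    t ℤ.* + c ℤ.+ + a       ≡⟨ t*c+a≡b*z ⟩
    + b ℤ.* z               ≤⟨ ℤP.*-monoˡ-≤-nonNeg (+ b) z≤c ⟩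
    + b ℤ.* + c             ∎)
  where open ℤP.≤-Reasoning

-- The tree MT(k)

record IsMarkovTriple (k a b c : ℕ) : Set where
  field
    a>0 : 0 < a
    b>0 : 0 < b
    c>0 : 0 < c
    markov : markovForm (+ k) (+ a) (+ b) (+ c) ≡ + 0
    coprime-ab : Coprime a b
    coprime-bc : Coprime b c
    coprime-ca : Coprime c a

IsMarkovTriple-rotate : ∀ {k a b c} → IsMarkovTriple k a b c → IsMarkovTriple k b c a
IsMarkovTriple-rotate {k} {a} {b} {c} t = record
  { a>0 = b>0 ; b>0 = c>0 ; c>0 = a>0
  ; markov = trans (sym (markovForm-rotate (+ k) (+ a) (+ b) (+ c))) markov
  ; coprime-ab = coprime-bc ; coprime-bc = coprime-ca ; coprime-ca = coprime-ab
  }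
  where open IsMarkovTriple t

module MarkovL {k a b c} (t : IsMarkovTriple k a b c) where
  open IsMarkovTriple t

  private
    K : ℤ
    K = + k
    q b′ : ℕ
    q = a * a + k * a * b + b * b
    b′ = divℕ q c

  c*vieta≡q : + c ℤ.* vieta K (+ a) (+ b) (+ c) ≡ + q
  c*vieta≡q = begin
    + c ℤ.* vieta K (+ a) (+ b) (+ c)
      ≡⟨ vieta-product K (+ a) (+ b) (+ c) ⟩
    + a ℤ.* + a ℤ.+ K ℤ.* + a ℤ.* + b ℤ.+ + b ℤ.* + b ℤ.- markovForm K (+ a) (+ b) (+ c)
      ≡⟨ cong (λ m → + a ℤ.* + a ℤ.+ K ℤ.* + a ℤ.* + b ℤ.+ + b ℤ.* + b ℤ.- m) markov ⟩
    + a ℤ.* + a ℤ.+ K ℤ.* + a ℤ.* + b ℤ.+ + b ℤ.* + b ℤ.+ + 0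
      ≡⟨ ℤP.+-identityʳ _ ⟩
    + a ℤ.* + a ℤ.+ K ℤ.* + a ℤ.* + b ℤ.+ + b ℤ.* + b
      ≡⟨ pos-quadratic k a b ⟨
    + q ∎
    where open ≡-Reasoning

  c*b′≡q : c * b′ ≡ q
  c*b′≡q = proj₁ (exact-quotient c>0 c*vieta≡q)

  b′≡vieta : + b′ ≡ vieta K (+ a) (+ b) (+ c)
  b′≡vieta = proj₂ (exact-quotient c>0 c*vieta≡q)

  isMarkovTriple : IsMarkovTriple k a b′ b
  isMarkovTriple = record
    { a>0 = a>0
    ; b>0 = quotient-positive {c} (quadratic-positive k a b a>0) c*b′≡q
    ; c>0 = b>0
    ; markov = trans (cong (λ x → markovForm K (+ a) x (+ b)) b′≡vieta)
                     (trans (markovForm-vieta K (+ a) (+ b) (+ c)) markov)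
    ; coprime-ab = coprime-jump {c = c} coprime-ab (trans c*b′≡q (expand-a k a b))
    ; coprime-bc = Coprime.sym
        (coprime-jump {c = c} (Coprime.sym coprime-ab) (trans c*b′≡q (expand-b k a b)))
    ; coprime-ca = Coprime.sym coprime-ab
    }
    where
    expand-a : ∀ k a b → a * a + k * a * b + b * b ≡ a * (a + k * b) + b * b
    expand-a = ℕSolver.solve-∀
    expand-b : ∀ k a b → a * a + k * a * b + b * b ≡ b * (k * a + b) + a * a
    expand-b = ℕSolver.solve-∀

-- MMT(k,0) over MT(k)

-- The two inequalities place the lower right entry of the middle matrix in (0, b - k).
record IsLift (k : ℕ) (X Y Z : Mat2) (a b c : ℕ) : Set where
  field
    mm : IsMMTriple (+ k) X Y Z
    markov : IsMarkovTriple k a b c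
    e12X : e12 X ≡ + a
    e12Y : e12 Y ≡ + b
    e12Z : e12 Z ≡ + c
    e22X+k≥0 : + 0 ℤ.≤ e22 X ℤ.+ + k
    e22Z≤c : e22 Z ℤ.≤ + c

Lift : ℕ → Triple Mat2 → Triple ℕ → Set
Lift k (X , Y , Z) (a , b , c) = IsLift k X Y Z a b c

module IsLiftProperties {k X Y Z a b c} (ℓ : IsLift k X Y Z a b c) where
  open IsLift ℓ
  open IsMarkovTriple markov
  open IsMMTriple mm using (trY)
  open IsMMTripleProperties mm

  subst-e12 : (P : ℤ → ℤ → ℤ → Set) → P (e12 X) (e12 Y) (e12 Z) → P (+ a) (+ b) (+ c)
  subst-e12 P p rewrite e12X | e12Y | e12Z = p

  mmL-e12 : e12 (Y · Z · inv Y) ≡ vieta (+ k) (+ a) (+ b) (+ c)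
  mmL-e12 = subst-e12 (λ x y z → e12 (Y · Z · inv Y) ≡ vieta (+ k) x y z) e12-conjˡ

  mmR-e12 : e12 (inv Y · X · Y) ≡ vieta (+ k) (+ b) (+ c) (+ a)
  mmR-e12 = subst-e12 (λ x y z → e12 (inv Y · X · Y) ≡ vieta (+ k) y z x) e12-conjʳ

  a·e22Y : + a ℤ.* e22 Y ≡ + c ℤ.+ + b ℤ.* (e22 X ℤ.+ + k)
  a·e22Y = subst-e12 (λ x y z → x ℤ.* e22 Y ≡ z ℤ.+ y ℤ.* (e22 X ℤ.+ + k)) e12X·e22Y

  e22Y+k·c : (e22 Y ℤ.+ + k) ℤ.* + c ℤ.+ + a ≡ + b ℤ.* e22 Z
  e22Y+k·c = subst-e12 (λ x y z → (e22 Y ℤ.+ + k) ℤ.* z ℤ.+ x ≡ y ℤ.* e22 Z) e22Y+K·e12Z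

  e22Y>0 : + 0 ℤ.< e22 Y
  e22Y>0 = factor-positive {b = b} a>0 c>0 e22X+k≥0 a·e22Y

  e22Y+k<b : e22 Y ℤ.+ + k ℤ.< + b
  e22Y+k<b = factor-below a>0 e22Z≤c e22Y+k·c

  e22Y≤b : e22 Y ℤ.≤ + b
  e22Y≤b = ℤP.≤-trans (ℤP.i≤i+j (e22 Y) (+ k)) (ℤP.<⇒≤ e22Y+k<b)

  e22Y+k≥0 : + 0 ℤ.≤ e22 Y ℤ.+ + k
  e22Y+k≥0 = ℤP.≤-trans (ℤP.<⇒≤ e22Y>0) (ℤP.i≤i+j (e22 Y) (+ k))

  u⁺ : ℕ
  u⁺ = ℤ.∣ e22 Y ∣

  e22Y≡u⁺ : e22 Y ≡ + u⁺
  e22Y≡u⁺ = sym (ℤP.0≤i⇒+∣i∣≡i (ℤP.<⇒≤ e22Y>0))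

  u⁺+k<b : u⁺ + k < b
  u⁺+k<b = ℤP.drop‿+<+ (subst (λ y → y ℤ.+ + k ℤ.< + b) e22Y≡u⁺ e22Y+k<b)

  u⁺<b : u⁺ < b
  u⁺<b = ℕP.≤-<-trans (ℕP.m≤m+n u⁺ k) u⁺+k<b

  b∣a·u⁺-c : + b ℤ∣.∣ + a ℤ.* + u⁺ ℤ.- + c
  b∣a·u⁺-c = ℤ∣ˢ.∣⇒∣ᵤ (ℤ∣ˢ.divides (e22 X ℤ.+ + k)
    (rearrange (+ b) (+ c) (e22 X ℤ.+ + k) (subst (λ y → + a ℤ.* y ≡ _) e22Y≡u⁺ a·e22Y)))
    where
    rearrange : ∀ {A} B C S → A ≡ C ℤ.+ B ℤ.* S → A ℤ.- C ≡ S ℤ.* B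
    rearrange B C S refl = solve (B ∷ C ∷ S ∷ [])

  b∣c·[u⁺+k]+a : + b ℤ∣.∣ + c ℤ.* + (u⁺ + k) ℤ.+ + a
  b∣c·[u⁺+k]+a = ℤ∣ˢ.∣⇒∣ᵤ (ℤ∣ˢ.divides (e22 Z)
    (rearrange (+ (u⁺ + k)) (+ c) (+ a) (+ b) (e22 Z)
               (subst (λ y → (y ℤ.+ + k) ℤ.* + c ℤ.+ + a ≡ _) e22Y≡u⁺ e22Y+k·c)))
    where
    rearrange : ∀ T C A B Z → T ℤ.* C ℤ.+ A ≡ B ℤ.* Z → C ℤ.* T ℤ.+ A ≡ Z ℤ.* B
    rearrange T C A B Z T*C+A≡B*Z =
      trans (cong (ℤ._+ A) (ℤP.*-comm C T)) (trans T*C+A≡B*Z (ℤP.*-comm B Z))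

  b·[-e21Y] : + b ℤ.* (- e21 Y) ≡ + (u⁺ * (u⁺ + k) + 1)
  b·[-e21Y] = trans (subst₂ (λ β y → β ℤ.* (- e21 Y) ≡ y ℤ.* (y ℤ.+ + k) ℤ.+ + 1) e12Y e22Y≡u⁺ e12Y·-e21Y)
                    (sym (cong (ℤ._+ + 1) (ℤP.pos-* u⁺ (u⁺ + k))))

  Y-shape : Y ≡ mat (- + (u⁺ + k)) (+ b) (- + divℕ (u⁺ * (u⁺ + k) + 1) b) (+ u⁺)
  Y-shape = mat-cong
    (trans (e11-from-tr Y trY) (cong (λ y → - (y ℤ.+ + k)) e22Y≡u⁺))
    e12Y
    (trans (sym (ℤP.neg-involutive (e21 Y))) (cong -_ (sym (proj₂ (exact-quotient b>0 b·[-e21Y])))))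
    e22Y≡u⁺

  middle-matrix : ∀ {u v} → u < b → + b ℤ∣.∣ + a ℤ.* + u ℤ.- + c → v < b → + b ℤ∣.∣ + c ℤ.* + v ℤ.+ + a →
    (b ∣ u * v + 1) × (Y ≡ mat (- + v) (+ b) (- + divℕ (u * v + 1) b) (+ u))
  middle-matrix {u} {v} u<b b∣a·u-c v<b b∣c·v+a =
    subst₂ (λ u v → (b ∣ u * v + 1) × (Y ≡ mat (- + v) (+ b) (- + divℕ (u * v + 1) b) (+ u)))
           (sym u≡u⁺) (sym v≡u⁺+k)
           (ℕ∣.divides (divℕ (u⁺ * (u⁺ + k) + 1) b)
                       (trans (sym (proj₁ (exact-quotient b>0 b·[-e21Y]))) (ℕP.*-comm b _))
           , Y-shape)
    where
    u≡u⁺ : u ≡ u⁺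
    u≡u⁺ = residue-unique (- + c) (Coprime.sym coprime-ab) u<b u⁺<b b∣a·u-c b∣a·u⁺-c
    v≡u⁺+k : v ≡ u⁺ + k
    v≡u⁺+k = residue-unique (+ a) coprime-bc v<b u⁺+k<b b∣c·v+a b∣c·[u⁺+k]+a

mmL-lift : ∀ {k T M} → Lift k T M → Lift k (mmL T) (markovL k M)
mmL-lift {k} {X , Y , Z} {a , b , c} ℓ = record
  { mm = mmL-preserves (X , Y , Z) mm
  ; markov = MarkovL.isMarkovTriple markov
  ; e12X = e12X
  ; e12Y = trans mmL-e12 (sym (MarkovL.b′≡vieta markov))
  ; e12Z = e12Y
  ; e22X+k≥0 = e22X+k≥0
  ; e22Z≤c = e22Y≤b
  }
  where open IsLift ℓ; open IsLiftProperties ℓ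

mmR-lift : ∀ {k T M} → Lift k T M → Lift k (mmR T) (markovR k M)
mmR-lift {k} {X , Y , Z} {a , b , c} ℓ = record
  { mm = mmR-preserves (X , Y , Z) mm
  ; markov = MarkovL.isMarkovTriple (IsMarkovTriple-rotate markov)
  ; e12X = e12Y
  ; e12Y = trans mmR-e12 (sym (MarkovL.b′≡vieta (IsMarkovTriple-rotate markov)))
  ; e12Z = e12Z
  ; e22X+k≥0 = e22Y+k≥0
  ; e22Z≤c = e22Z≤c
  }
  where open IsLift ℓ; open IsLiftProperties ℓ

root-lift : ∀ k → Lift k (mmRoot k) (markovRoot k)
root-lift k = record
  { mm = mmRoot-isMMTriple k
  ; markov = record
    { a>0 = ℕ.s≤s ℕ.z≤n
    ; b>0 = ℕP.<-≤-trans (ℕ.s≤s ℕ.z≤n) (ℕP.m≤n+m 2 k)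
    ; c>0 = ℕ.s≤s ℕ.z≤n
    ; markov = root-markov (+ k)
    ; coprime-ab = Coprime.1-coprimeTo (k + 2)
    ; coprime-bc = Coprime.sym (Coprime.1-coprimeTo (k + 2))
    ; coprime-ca = Coprime.1-coprimeTo 1
    }
  ; e12X = refl ; e12Y = refl ; e12Z = refl
  ; e22X+k≥0 = ℤP.≤-reflexive (sym (ℤP.+-inverseˡ (+ k)))
  ; e22Z≤c = ℤP.≤-refl
  }
  where
  root-markov : ∀ K →
    + 1 ℤ.* + 1 ℤ.+ (K ℤ.+ + 2) ℤ.* (K ℤ.+ + 2) ℤ.+ + 1 ℤ.* + 1
      ℤ.+ K ℤ.* (+ 1 ℤ.* (K ℤ.+ + 2) ℤ.+ (K ℤ.+ + 2) ℤ.* + 1 ℤ.+ + 1 ℤ.* + 1)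
      ℤ.- (+ 3 ℤ.* K ℤ.+ + 3) ℤ.* + 1 ℤ.* (K ℤ.+ + 2) ℤ.* + 1 ≡ + 0
  root-markov = solve-∀

mmAt-lift : ∀ k p → Lift k (mmAt k p) (markovAt k p)
mmAt-lift k p = walk-related (Lift k) mmL-lift mmR-lift p (root-lift k)

theorem7p27 : (k a b : ℕ) → Coprime a b → 0 < a → a < b →
    (p : List Dir) → midT (fareyAt p) ≡ (a , b) →
    (u v : ℕ) → IsUPlus k p u → IsVMinus k p v →
    (m-t k p ∣ u * v + 1)
    × (Mt k p ≡ mat (- (+ v)) (+ m-t k p) (- (+ w-of k p u v)) (+ u))
    × (Ct k p ≡ mat (+ u) (+ m-t k p)
                    ((+ 3 ℤ.* + k ℤ.+ + 3) ℤ.* + u ℤ.- + w-of k p u v)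
                    ((+ 3 ℤ.* + k ℤ.+ + 3) ℤ.* + m-t k p ℤ.- + v))
-- The Farey data a/b only names the vertex p: the identities hold at every vertex.
theorem7p27 k _ _ _ _ _ p _ u v (_ , u<m , m∣a·u-c) (_ , v<m , m∣c·v+a) =
  let m∣uv+1 , Mt≡ = middle-matrix u<m m∣a·u-c v<m m∣c·v+a in
  m∣uv+1 , Mt≡ , trans (cong midT (gcAt≡φ-mmAt k p)) (cong (φ (κ (+ k))) Mt≡)
  where open IsLiftProperties (mmAt-lift k p)
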